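{- If $G$ is complementary vanishing and does not have a dominating vertex, then $G\sqcup K_1$ is $\beta$-robust.
   Context: For a graph $G$ with vertex set $\{v_1,\dots,v_n\}$, $\mathcal{S}(G)$ is the set of real symmetric $n\times n$ matrices $A=[a_{i,j}]$ such that for $i\neq j$, $a_{i,j}\neq 0$ if and only if $v_iv_j\in E(G)$ (diagonal entries are unrestricted). $\overline{G}$ is the complement of $G$. $G$ is complementary vanishing if there exist $A\in\mathcal{S}(G)$, $B\in\mathcal{S}(\overline{G})$ with $AB=O$. $G$ is $\beta$-robust if there exist such $A,B$ with $AB=O$ and $\ker(B)$ containing a nowhere-zero vector (all entries nonzero). $G\sqcup K_1$ is $G$ with an added isolated vertex. A dominating vertex is adjacent to all other vertices. -}

module Defs where

open import Level using (0ℓ)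
open import Data.Nat using (ℕ; zero; suc)
open import Data.Fin using (Fin; zero; suc)
open import Data.Bool using (Bool; true; false; not)
open import Data.Product using (Σ; ∃; _×_; _,_)
open import Relation.Nullary using (¬_; yes; no)
open import Relation.Binary.PropositionalEquality using (_≡_; _≢_)
open import Data.Sum using (_⊎_)
open import Function.Bundles using (_⇔_)
import Algebra.Structures as AS
import Relation.Binary.Structures as RS
import Data.Fin.Properties as FinP

-- An axiomatisation of the real numbers: a complete ordered field
-- (unique up to isomorphism, so this is ℝ).
record Reals : Set₁ where
  infixl 6 _+_
  infixl 7 _*_
  infix 4 _<_
  field
    Carrier : Set
    _+_ _*_ : Carrier → Carrier → Carrier
    -_ : Carrier → Carrier
    0# 1# : Carrier
    _<_ : Carrier → Carrier → Set
    isCommutativeRing : AS.IsCommutativeRing {A = Carrier} _≡_ _+_ _*_ -_ 0# 1#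
    inverse : ∀ x → x ≢ 0# → Σ Carrier (λ y → x * y ≡ 1#)
    0≢1 : 0# ≢ 1#
    isStrictTotalOrder : RS.IsStrictTotalOrder {A = Carrier} _≡_ _<_
    +-mono-< : ∀ {x y} z → x < y → x + z < y + z
    *-pos : ∀ {x y} → 0# < x → 0# < y → 0# < x * y
    completeness : (P : Carrier → Set) → Σ Carrier P →
      Σ Carrier (λ b → ∀ x → P x → (x < b) ⊎ (x ≡ b)) →
      Σ Carrier (λ s → (∀ x → P x → (x < s) ⊎ (x ≡ s)) ×
                       (∀ b → (∀ x → P x → (x < b) ⊎ (x ≡ b)) → (s < b) ⊎ (s ≡ b)))

record Graph (n : ℕ) : Set where
  field
    adj : Fin n → Fin n → Bool
    sym : ∀ i j → adj i j ≡ adj j i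
    irrefl : ∀ i → adj i i ≡ false
open Graph public using (adj)

complementAdj : ∀ {n} → Graph n → Fin n → Fin n → Bool
complementAdj G i j with i FinP.≟ j
... | yes _ = false
... | no _ = not (adj G i j)

complement : ∀ {n} → Graph n → Graph n
complement {n} G = record { adj = complementAdj G ; sym = s ; irrefl = ir }
  where
  open import Relation.Binary.PropositionalEquality using (refl; sym; cong)
  s : ∀ i j → complementAdj G i j ≡ complementAdj G j i
  s i j with i FinP.≟ j | j FinP.≟ i
  ... | yes _ | yes _ = refl
  ... | yes p | no q = Data.Empty.⊥-elim (q (sym p)) where import Data.Empty
  ... | no p | yes q = Data.Empty.⊥-elim (p (sym q)) where import Data.Empty
  ... | no _ | no _ = cong not (Graph.sym G i j)
  ir : ∀ i → complementAdj G i i ≡ false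
  ir i with i FinP.≟ i
  ... | yes _ = refl
  ... | no p = Data.Empty.⊥-elim (p refl) where import Data.Empty

-- G ⊔ K₁ : the new isolated vertex is vertex zero; old vertex i becomes suc i.
addIsolatedAdj : ∀ {n} → Graph n → Fin (suc n) → Fin (suc n) → Bool
addIsolatedAdj G zero j = false
addIsolatedAdj G (suc i) zero = false
addIsolatedAdj G (suc i) (suc j) = adj G i j

_⊔K₁ : ∀ {n} → Graph n → Graph (suc n)
_⊔K₁ {n} G = record { adj = addIsolatedAdj G ; sym = s ; irrefl = ir }
  where
  open import Relation.Binary.PropositionalEquality using (refl)
  s : ∀ i j → addIsolatedAdj G i j ≡ addIsolatedAdj G j i
  s zero zero = refl
  s zero (suc j) = refl
  s (suc i) zero = refl
  s (suc i) (suc j) = Graph.sym G i j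
  ir : ∀ i → addIsolatedAdj G i i ≡ false
  ir zero = refl
  ir (suc i) = Graph.irrefl G i

HasDominatingVertex : ∀ {n} → Graph n → Set
HasDominatingVertex {n} G = Σ (Fin n) (λ v → ∀ u → u ≢ v → adj G v u ≡ true)

module _ (ℝ : Reals) where
  open Reals ℝ

  Matrix : ℕ → Set
  Matrix n = Fin n → Fin n → Carrier

  sumFin : ∀ {n} → (Fin n → Carrier) → Carrier
  sumFin {zero} f = 0#
  sumFin {suc n} f = f zero + sumFin (λ k → f (suc k))

  InS : ∀ {n} → Graph n → Matrix n → Set
  InS G A = (∀ i j → A i j ≡ A j i) ×
            (∀ i j → i ≢ j → (A i j ≢ 0#) ⇔ (adj G i j ≡ true))

  ProductZero : ∀ {n} → Matrix n → Matrix n → Set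
  ProductZero A B = ∀ i j → sumFin (λ k → A i k * B k j) ≡ 0#

  ComplementaryVanishing : ∀ {n} → Graph n → Set
  ComplementaryVanishing {n} G =
    Σ (Matrix n) (λ A → Σ (Matrix n) (λ B →
      InS G A × InS (complement G) B × ProductZero A B))

  NowhereZeroKernelVector : ∀ {n} → Matrix n → (Fin n → Carrier) → Set
  NowhereZeroKernelVector B x =
    (∀ i → x i ≢ 0#) × (∀ i → sumFin (λ k → B i k * x k) ≡ 0#)

  BetaRobust : ∀ {n} → Graph n → Set
  BetaRobust {n} G =
    Σ (Matrix n) (λ A → Σ (Matrix n) (λ B →
      InS G A × InS (complement G) B × ProductZero A B ×
      Σ (Fin n → Carrier) (NowhereZeroKernelVector B)))

{-# OPTIONS --safe #-}
module Submission where

open import Defs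
open import Data.Nat using (ℕ; zero; suc)
open import Data.Fin using (Fin; zero; suc)
open import Data.Bool using (true; not)
open import Data.Bool.Properties using (not-injective; ¬-not)
open import Data.Product using (∃; _×_; _,_; proj₁; proj₂)
open import Data.Empty using (⊥-elim)
open import Data.Vec.Functional using (Vector; _∷_)
open import Relation.Nullary using (¬_; Dec; yes; no)
open import Relation.Binary.PropositionalEquality
open import Relation.Binary.Definitions using (tri<; tri≈; tri>)
open import Function.Bundles using (_⇔_; mk⇔; Equivalence)
import Algebra.Bundles as Bundles
import Algebra.Properties.Ring as RingProperties
import Algebra.Properties.Semiring.Sum as SemiringSum
import Relation.Binary.Structures as RS
import Data.Fin.Properties as FinP

-- If G has no dominating vertex, every row of B ∈ 𝒮(Ḡ) has a nonzero entry. A nowhere-zero z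
-- can then be chosen, one coordinate at a time and each time avoiding finitely many bad values,
-- so that y = Bz is nowhere zero as well. Border A by zeros and B by y, with corner zᵀy: since
-- Ay = ABz = 0 the product still vanishes, the new vertex is joined in the complement to every
-- old vertex precisely because y is nowhere zero, and (-1, z) is a nowhere-zero kernel vector
-- of the bordered B.

complementAdj-≢ : ∀ {n} (G : Graph n) {i j} → i ≢ j → complementAdj G i j ≡ not (adj G i j)
complementAdj-≢ G {i} {j} i≢j with i FinP.≟ j
... | yes i≡j = ⊥-elim (i≢j i≡j)
... | no _ = refl

module OverReals (ℝ : Reals) where
  open Reals ℝ

  commutativeRing : Bundles.CommutativeRing _ _
  commutativeRing = record { isCommutativeRing = isCommutativeRing }

  open Bundles.CommutativeRing commutativeRing
    using ( ring; semiring; +-identityˡ; -‿inverseˡ; -‿inverseʳ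
          ; *-assoc; *-comm; *-identityˡ; zeroˡ )
  open RingProperties ring using (-1*x≈-x; -‿involutive; -‿injective; -0#≈0#; +-inverseˡ-unique)
  open SemiringSum semiring
    using (sum; sum-cong-≗; sum-replicate-zero; ∑-comm; *-distribˡ-sum; *-distribʳ-sum)
  module O = RS.IsStrictTotalOrder isStrictTotalOrder
  open ≡-Reasoning

  0<1 : 0# < 1#
  0<1 with O.compare 0# 1#
  ... | tri< 0<1 _ _ = 0<1
  ... | tri≈ _ 0≡1 _ = ⊥-elim (0≢1 0≡1)
  ... | tri> _ _ 1<0 = ⊥-elim (O.asym 1<0 (subst (0# <_) -1*-1≡1 (*-pos 0<-1 0<-1)))
    where
    0<-1 : 0# < - 1#
    0<-1 = subst₂ _<_ (-‿inverseʳ 1#) (+-identityˡ (- 1#)) (+-mono-< (- 1#) 1<0)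
    -1*-1≡1 : - 1# * - 1# ≡ 1#
    -1*-1≡1 = trans (-1*x≈-x (- 1#)) (-‿involutive 1#)

  x<1+x : ∀ x → x < 1# + x
  x<1+x x = subst (_< 1# + x) (+-identityˡ x) (+-mono-< x 0<1)

  -1≢0 : - 1# ≢ 0#
  -1≢0 -1≡0 = 0≢1 (sym (-‿injective (trans -1≡0 (sym -0#≈0#))))

  below-1+head : ∀ {p} (g : Vector Carrier (suc p)) → (∀ i → g (suc i) < g zero) →
                 ∀ i → g i < 1# + g zero
  below-1+head g tail<head zero = x<1+x (g zero)
  below-1+head g tail<head (suc i) = O.trans (tail<head i) (x<1+x (g zero))

  ∃-strictUpperBound : ∀ {p} (g : Vector Carrier p) → ∃ λ s → ∀ i → g i < s
  ∃-strictUpperBound {zero} g = 0# , λ ()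
  ∃-strictUpperBound {suc p} g with ∃-strictUpperBound (λ i → g (suc i))
  ... | b , tail<b with O.compare (g zero) b
  ...   | tri< g₀<b _ _ = b , λ { zero → g₀<b ; (suc i) → tail<b i }
  ...   | tri≈ _ g₀≡b _ =
    1# + g zero , below-1+head g (λ i → subst (g (suc i) <_) (sym g₀≡b) (tail<b i))
  ...   | tri> _ _ b<g₀ = 1# + g zero , below-1+head g (λ i → O.trans (tail<b i) b<g₀)

  affine-root : ∀ {f s r y} → f * y ≡ 1# → f * s + r ≡ 0# → s ≡ - r * y
  affine-root {f} {s} {r} {y} fy≡1 fs+r≡0 = begin
    s           ≡⟨ sym (*-identityˡ s) ⟩
    1# * s      ≡⟨ cong (_* s) (trans (sym fy≡1) (*-comm f y)) ⟩
    y * f * s   ≡⟨ *-assoc y f s ⟩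
    y * (f * s) ≡⟨ cong (y *_) (+-inverseˡ-unique (f * s) r fs+r≡0) ⟩
    y * - r     ≡⟨ *-comm y (- r) ⟩
    - r * y     ∎

  -- The solution s of f * s + r = 0 when f ≠ 0; when f = 0 any value will do.
  root : (f r : Carrier) → Dec (f ≡ 0#) → Carrier
  root f r (yes _) = 0#
  root f r (no f≢0) = - r * proj₁ (inverse f f≢0)

  root-avoided : ∀ {f r s} (f≟0 : Dec (f ≡ 0#)) → root f r f≟0 < s →
                 f * s + r ≡ 0# → f ≡ 0# × r ≡ 0#
  root-avoided {f} {r} {s} (yes f≡0) _ fs+r≡0 = f≡0 , (begin
    r          ≡⟨ sym (+-identityˡ r) ⟩
    0# + r     ≡⟨ cong (_+ r) (sym (trans (cong (_* s) f≡0) (zeroˡ s))) ⟩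
    f * s + r  ≡⟨ fs+r≡0 ⟩
    0#         ∎)
  root-avoided {f} (no f≢0) root<s fs+r≡0 =
    ⊥-elim (O.irrefl (sym (affine-root (proj₂ (inverse f f≢0)) fs+r≡0)) root<s)

  infix 7 _·_
  _·_ : ∀ {m} → Vector Carrier m → Vector Carrier m → Carrier
  y · z = sum (λ k → y k * z k)

  infixr 7 _*ᵥ_
  _*ᵥ_ : ∀ {p m} → (Fin p → Fin m → Carrier) → Vector Carrier m → Vector Carrier p
  (F *ᵥ z) i = F i · z

  nowhereZero-detectingZeroRows : ∀ {p m} (F : Fin p → Fin m → Carrier) →
    ∃ λ z → (∀ k → z k ≢ 0#) × (∀ i → (F *ᵥ z) i ≡ 0# → ∀ k → F i k ≡ 0#)
  nowhereZero-detectingZeroRows {m = zero} F = (λ ()) , (λ ()) , λ _ _ ()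
  nowhereZero-detectingZeroRows {p} {suc m} F
    with nowhereZero-detectingZeroRows (λ i k → F i (suc k))
  ... | z , z≢0 , detect = s ∷ z , s∷z≢0 , detect′
    where
    bad : Vector Carrier p
    bad i = root (F i zero) (((λ i k → F i (suc k)) *ᵥ z) i) (F i zero O.≟ 0#)
    s : Carrier
    s = proj₁ (∃-strictUpperBound (0# ∷ bad))
    above : ∀ i → (0# ∷ bad) i < s
    above = proj₂ (∃-strictUpperBound (0# ∷ bad))
    s∷z≢0 : ∀ k → (s ∷ z) k ≢ 0#
    s∷z≢0 zero s≡0 = O.irrefl (sym s≡0) (above zero)
    s∷z≢0 (suc k) = z≢0 k
    detect′ : ∀ i → (F *ᵥ (s ∷ z)) i ≡ 0# → ∀ k → F i k ≡ 0#
    detect′ i Fz≡0 zero = proj₁ (root-avoided (F i zero O.≟ 0#) (above (suc i)) Fz≡0)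
    detect′ i Fz≡0 (suc k) =
      detect i (proj₂ (root-avoided (F i zero O.≟ 0#) (above (suc i)) Fz≡0)) k

  sumFin≡sum : ∀ {n} (f : Vector Carrier n) → sumFin ℝ f ≡ sum f
  sumFin≡sum {zero} f = refl
  sumFin≡sum {suc n} f = cong (f zero +_) (sumFin≡sum (λ k → f (suc k)))

  sum-zero : ∀ {n} {f : Vector Carrier n} → (∀ k → f k ≡ 0#) → sum f ≡ 0#
  sum-zero {n} f≡0 = trans (sum-cong-≗ f≡0) (sum-replicate-zero n)

  *ᵥ-productZero : ∀ {n} {A B : Matrix ℝ n} → ProductZero ℝ A B → ∀ z i → (A *ᵥ B *ᵥ z) i ≡ 0#
  *ᵥ-productZero {A = A} {B} AB≡0 z i = begin
    sum (λ k → A i k * sum (λ l → B k l * z l))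
      ≡⟨ sum-cong-≗ (λ k → *-distribˡ-sum (A i k) (λ l → B k l * z l)) ⟩
    sum (λ k → sum (λ l → A i k * (B k l * z l)))
      ≡⟨ ∑-comm (λ k l → A i k * (B k l * z l)) ⟩
    sum (λ l → sum (λ k → A i k * (B k l * z l)))
      ≡⟨ sum-cong-≗ (λ l → sum-cong-≗ (λ k → sym (*-assoc (A i k) (B k l) (z l)))) ⟩
    sum (λ l → sum (λ k → A i k * B k l * z l))
      ≡⟨ sum-cong-≗ (λ l → sym (*-distribʳ-sum (z l) (λ k → A i k * B k l))) ⟩
    sum (λ l → sum (λ k → A i k * B k l) * z l)
      ≡⟨ sum-zero (λ l → trans (cong (_* z l) (AB≡0′ l)) (zeroˡ (z l))) ⟩
    0# ∎
    where
    AB≡0′ : ∀ l → sum (λ k → A i k * B k l) ≡ 0#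
    AB≡0′ l = trans (sym (sumFin≡sum (λ k → A i k * B k l))) (AB≡0 i l)

  border : ∀ {n} → Carrier → Vector Carrier n → Matrix ℝ n → Matrix ℝ (suc n)
  border c y B zero zero = c
  border c y B zero (suc j) = y j
  border c y B (suc i) zero = y i
  border c y B (suc i) (suc j) = B i j

  border-sym : ∀ {n c y} {B : Matrix ℝ n} → (∀ i j → B i j ≡ B j i) →
               ∀ i j → border c y B i j ≡ border c y B j i
  border-sym B-sym zero zero = refl
  border-sym B-sym zero (suc j) = refl
  border-sym B-sym (suc i) zero = refl
  border-sym B-sym (suc i) (suc j) = B-sym i j

  InS-⊔K₁ : ∀ {n} {G : Graph n} {A : Matrix ℝ n} →
            InS ℝ G A → InS ℝ (G ⊔K₁) (border 0# (λ _ → 0#) A)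
  InS-⊔K₁ {G = G} {A} (A-sym , A-support) = border-sym A-sym , support
    where
    support : ∀ i j → i ≢ j → (border 0# (λ _ → 0#) A i j ≢ 0#) ⇔ (adj (G ⊔K₁) i j ≡ true)
    support zero zero 0≢0 = ⊥-elim (0≢0 refl)
    support zero (suc j) _ = mk⇔ (λ 0≢0 → ⊥-elim (0≢0 refl)) (λ ())
    support (suc i) zero _ = mk⇔ (λ 0≢0 → ⊥-elim (0≢0 refl)) (λ ())
    support (suc i) (suc j) si≢sj = A-support i j (λ i≡j → si≢sj (cong suc i≡j))

  InS-complement-⊔K₁ : ∀ {n} {G : Graph n} {B : Matrix ℝ n} {c y} →
    InS ℝ (complement G) B → (∀ j → y j ≢ 0#) →
    InS ℝ (complement (G ⊔K₁)) (border c y B)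
  InS-complement-⊔K₁ {G = G} {B} {c} {y} (B-sym , B-support) y≢0 = border-sym B-sym , support
    where
    support : ∀ i j → i ≢ j → (border c y B i j ≢ 0#) ⇔ (adj (complement (G ⊔K₁)) i j ≡ true)
    support zero zero 0≢0 = ⊥-elim (0≢0 refl)
    support zero (suc j) _ = mk⇔ (λ _ → refl) (λ _ → y≢0 j)
    support (suc i) zero _ = mk⇔ (λ _ → refl) (λ _ → y≢0 i)
    support (suc i) (suc j) si≢sj =
      subst (λ b → (B i j ≢ 0#) ⇔ (b ≡ true)) (sym complementAdj-suc) (B-support i j i≢j)
      where
      i≢j : i ≢ j
      i≢j i≡j = si≢sj (cong suc i≡j)
      complementAdj-suc : complementAdj (G ⊔K₁) (suc i) (suc j) ≡ complementAdj G i j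
      complementAdj-suc = trans (complementAdj-≢ (G ⊔K₁) si≢sj) (sym (complementAdj-≢ G i≢j))

  border-productZero : ∀ {n} {A B : Matrix ℝ n} {c y} →
    ProductZero ℝ A B → (∀ i → (A *ᵥ y) i ≡ 0#) →
    ProductZero ℝ (border 0# (λ _ → 0#) A) (border c y B)
  border-productZero {n} {A} {B} {c} {y} AB≡0 Ay≡0 = product
    where
    0*x+s≡s : ∀ x {s} → 0# * x + s ≡ s
    0*x+s≡s x {s} = trans (cong (_+ s) (zeroˡ x)) (+-identityˡ s)
    product : ProductZero ℝ (border 0# (λ _ → 0#) A) (border c y B)
    product zero j = trans (sumFin≡sum row₀) (sum-zero {f = row₀} row₀≡0)
      where
      row₀ : Vector Carrier (suc n)
      row₀ k = border 0# (λ _ → 0#) A zero k * border c y B k j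
      row₀≡0 : ∀ k → row₀ k ≡ 0#
      row₀≡0 zero = zeroˡ (border c y B zero j)
      row₀≡0 (suc k) = zeroˡ (border c y B (suc k) j)
    product (suc i) zero = trans (0*x+s≡s c) (trans (sumFin≡sum (λ k → A i k * y k)) (Ay≡0 i))
    product (suc i) (suc j) = trans (0*x+s≡s (y j)) (AB≡0 i j)

  border-kernel : ∀ {n} (B : Matrix ℝ n) z → (∀ k → z k ≢ 0#) →
    NowhereZeroKernelVector ℝ (border ((B *ᵥ z) · z) (B *ᵥ z) B) (- 1# ∷ z)
  border-kernel B z z≢0 = nowhereZero , kernel
    where
    nowhereZero : ∀ k → (- 1# ∷ z) k ≢ 0#
    nowhereZero zero = -1≢0
    nowhereZero (suc k) = z≢0 k
    x*-1+s≡0 : ∀ x {s} → s ≡ x → x * - 1# + s ≡ 0#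
    x*-1+s≡0 x {s} s≡x = begin
      x * - 1# + s ≡⟨ cong₂ _+_ (trans (*-comm x (- 1#)) (-1*x≈-x x)) s≡x ⟩
      - x + x      ≡⟨ -‿inverseˡ x ⟩
      0#           ∎
    kernel : ∀ i → sumFin ℝ (λ k → border ((B *ᵥ z) · z) (B *ᵥ z) B i k * (- 1# ∷ z) k) ≡ 0#
    kernel zero = x*-1+s≡0 ((B *ᵥ z) · z) (sumFin≡sum (λ k → (B *ᵥ z) k * z k))
    kernel (suc i) = x*-1+s≡0 ((B *ᵥ z) i) (sumFin≡sum (λ k → B i k * z k))

  row-nonzero : ∀ {n} {G : Graph n} {B : Matrix ℝ n} → InS ℝ (complement G) B →
    ¬ HasDominatingVertex G → ∀ i → ¬ (∀ u → B i u ≡ 0#)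
  row-nonzero {G = G} (_ , B-support) noDominating i row≡0 = noDominating (i , adjacent)
    where
    adjacent : ∀ u → u ≢ i → adj G i u ≡ true
    adjacent u u≢i = not-injective (¬-not nonEdge)
      where
      i≢u : i ≢ u
      i≢u i≡u = u≢i (sym i≡u)
      nonEdge : not (adj G i u) ≢ true
      nonEdge edge = Equivalence.from (B-support i u i≢u)
        (trans (complementAdj-≢ G i≢u) edge) (row≡0 u)

corollary3p5 : (ℝ : Reals) {n : ℕ} (G : Graph n) →
    ComplementaryVanishing ℝ G → ¬ HasDominatingVertex G →
    BetaRobust ℝ (G ⊔K₁)
corollary3p5 ℝ G (A , B , A∈𝒮 , B∈𝒮 , AB≡0) noDominating =
  border 0# (λ _ → 0#) A , border (y · z) y B ,
  InS-⊔K₁ A∈𝒮 , InS-complement-⊔K₁ B∈𝒮 y≢0 ,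
  border-productZero AB≡0 (*ᵥ-productZero AB≡0 z) ,
  - 1# ∷ z , border-kernel B z z≢0
  where
  open Reals ℝ using (Carrier; 0#; 1#; -_)
  open OverReals ℝ
  generic : ∃ λ z → (∀ k → z k ≢ 0#) × (∀ i → (B *ᵥ z) i ≡ 0# → ∀ k → B i k ≡ 0#)
  generic = nowhereZero-detectingZeroRows B
  z : Vector Carrier _
  z = proj₁ generic
  z≢0 : ∀ k → z k ≢ 0#
  z≢0 = proj₁ (proj₂ generic)
  y : Vector Carrier _
  y = B *ᵥ z
  y≢0 : ∀ i → y i ≢ 0#
  y≢0 i yᵢ≡0 = row-nonzero B∈𝒮 noDominating i (proj₂ (proj₂ generic) i yᵢ≡0)
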